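{- Let $G$ be a finite block graph with $\alpha_{\min}(G)=1$, and let $X(G)=\max\left\{\omega(G),\left\lceil \frac{|V(G)|+1}{\alpha_{\min}(G)+1}\right\rceil\right\}$. Then $X(G)\leq \chi_=(G)\leq X(G)+1$.
   Context: A block graph is a graph in which every block (maximal 2-connected subgraph, or bridge) is a clique (maximal complete subgraph); $\omega(G)$ is the size of a largest clique. $\alpha(G,v)$ is the maximum size of an independent set of $G$ containing the vertex $v$, and $\alpha_{\min}(G)=\min_{v\in V(G)}\alpha(G,v)$. An equitable $k$-coloring is a proper vertex coloring with colors $\{1,\dots,k\}$ in which every color class has size $\lfloor |V(G)|/k\rfloor$ or $\lceil |V(G)|/k\rceil$; $\chi_=(G)$ is the smallest $k$ for which $G$ has an equitable $k$-coloring. -}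

module Defs where

open import Data.Nat using (ℕ; zero; suc; _+_; _≤_; _⊔_)
open import Data.Nat.DivMod using (_/_)
open import Data.Bool using (Bool; true; false)
open import Data.Fin using (Fin; _≟_)
open import Data.Fin.Subset using (Subset; _∈_; _⊆_; ∣_∣)
open import Data.Vec using (tabulate)
open import Data.Product using (Σ; ∃; _×_)
open import Data.Sum using (_⊎_)
open import Relation.Nullary using (¬_; does)
open import Relation.Binary.PropositionalEquality using (_≡_; _≢_)

-- floor and ceiling of m / k (value at k = 0 is an irrelevant convention)
⌊_/_⌋ : ℕ → ℕ → ℕ
⌊ m / zero ⌋ = 0
⌊ m / suc k ⌋ = m / suc k

⌈_/_⌉ : ℕ → ℕ → ℕ
⌈ m / zero ⌉ = 0
⌈ m / suc k ⌉ = (m + k) / suc k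

record Graph (n : ℕ) : Set where
  field
    adj    : Fin n → Fin n → Bool
    sym    : ∀ u v → adj u v ≡ adj v u
    irrefl : ∀ v → adj v v ≡ false

module _ {n : ℕ} (G : Graph n) where
  open Graph G

  Edge : Fin n → Fin n → Set
  Edge u v = adj u v ≡ true

  -- walks all of whose vertices after the start satisfy P
  data Walk (P : Fin n → Set) : Fin n → Fin n → Set where
    here : ∀ {u} → Walk P u u
    step : ∀ {u x w} → Edge u x → P x → Walk P x w → Walk P u w

  Connected : (Fin n → Set) → Set
  Connected P = ∀ u w → P u → P w → Walk P u w

  NonSeparable : Subset n → Set
  NonSeparable B = Connected (λ x → x ∈ B)
                 × (∀ v → v ∈ B → Connected (λ x → x ∈ B × x ≢ v))

  IsBlock : Subset n → Set
  IsBlock B = NonSeparable B × (∀ B' → B ⊆ B' → NonSeparable B' → B' ⊆ B)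

  IsClique : Subset n → Set
  IsClique S = ∀ u w → u ∈ S → w ∈ S → u ≢ w → Edge u w

  IsIndependent : Subset n → Set
  IsIndependent S = ∀ u w → u ∈ S → w ∈ S → ¬ Edge u w

  IsBlockGraph : Set
  IsBlockGraph = ∀ B → IsBlock B → IsClique B

  IsCliqueNumber : ℕ → Set
  IsCliqueNumber k = (Σ (Subset n) λ S → IsClique S × ∣ S ∣ ≡ k)
                   × (∀ S → IsClique S → ∣ S ∣ ≤ k)

  IsAlphaAt : Fin n → ℕ → Set
  IsAlphaAt v k = (Σ (Subset n) λ S → IsIndependent S × v ∈ S × ∣ S ∣ ≡ k)
                × (∀ S → IsIndependent S → v ∈ S → ∣ S ∣ ≤ k)

  IsAlphaMin : ℕ → Set
  IsAlphaMin a = (∃ λ v → IsAlphaAt v a) × (∀ w b → IsAlphaAt w b → a ≤ b)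

  IsProperColoring : {k : ℕ} → (Fin n → Fin k) → Set
  IsProperColoring c = ∀ u w → Edge u w → c u ≢ c w

  colorClassSize : {k : ℕ} → (Fin n → Fin k) → Fin k → ℕ
  colorClassSize c i = ∣ tabulate (λ v → does (c v ≟ i)) ∣

  IsEquitableColoring : (k : ℕ) → (Fin n → Fin k) → Set
  IsEquitableColoring k c = IsProperColoring c
    × (∀ i → colorClassSize c i ≡ ⌊ n / k ⌋ ⊎ colorClassSize c i ≡ ⌈ n / k ⌉)

  EquitablyColorable : ℕ → Set
  EquitablyColorable k = Σ (Fin n → Fin k) (IsEquitableColoring k)

  IsEqChromatic : ℕ → Set
  IsEqChromatic k = EquitablyColorable k × (∀ j → EquitablyColorable j → k ≤ j)

-- α_min(G) = 1 means that some vertex v is adjacent to all other vertices.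
-- Lower bound: a clique needs distinct colours, so ω ≤ χ; in an equitable colouring
-- the class of v is {v}, hence every class has at most two vertices and n ≤ 2χ − 1,
-- i.e. ⌈(n+1)/2⌉ ≤ χ.
-- Upper bound: for a path x − y − z in G − v the set {v, x, y, z} is non-separable,
-- so it lies in a block, which is a clique; hence G − v is a disjoint union of
-- cliques of fewer than ω vertices.  Listing the N = n − 1 vertices of G − v
-- component by component and colouring position p by p mod X, with an extra colour
-- for v, gives a proper colouring (ω ≤ X) whose classes are balanced (N ≤ 2X): an
-- equitable (X + 1)-colouring.
module Submission where

open import Defs
open import Algebra.Properties.CommutativeSemigroup using (interchange)
open import Data.Bool using (true; false; if_then_else_)
import Data.Bool.Properties as Bool
open import Data.Empty using (⊥; ⊥-elim)
open import Data.Fin using (Fin; zero; suc; toℕ; fromℕ; fromℕ<; _≟_)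
import Data.Fin.Properties as Fin
open import Data.Fin.Properties using (any?; toℕ-injective; toℕ-fromℕ<; toℕ-fromℕ; toℕ<n)
open import Data.Fin.Subset using (Subset; _∈_; _⊆_; _⊂_; ∣_∣)
open import Data.Fin.Subset.Properties using (_∈?_; _⊆?_; ∣p∣≤n; p⊂q⇒∣p∣<∣q∣)
import Data.Nat as ℕ
open import Data.Nat using (ℕ; zero; suc; _+_; _*_; _∸_; _≤_; _<_; _⊔_; _≤?_; _<?_; z≤n; s≤s; z<s;
                            NonZero; >-nonZero; >-nonZero⁻¹)
open import Data.Nat.DivMod using (_/_; _%_; /-monoˡ-≤; m*n/n≡m; m<n*o⇒m/o<n; m≡m%n+[m/n]*n;
                                   m/n≡1+[m∸n]/n; m%n<n; m<n⇒m%n≡m; [m+kn]%n≡m%n)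
open import Data.Nat.Properties hiding (_≟_)
open import Data.Product using (Σ; ∃; _×_; _,_; proj₁; proj₂)
open import Data.Sum using (_⊎_; inj₁; inj₂)
open import Data.Unit using (tt)
open import Data.Vec using ([]; _∷_; tabulate)
open import Data.Vec.Properties using (lookup∘tabulate; []=⇒lookup; lookup⇒[]=)
open import Function using (_∘_; id)
open import Relation.Binary using (tri<; tri≈; tri>)
open import Relation.Binary.PropositionalEquality
open import Relation.Nullary using (¬_; Dec; yes; no; does; ¬¬-excluded-middle)
open import Relation.Nullary.Decidable using (_×-dec_; _⊎-dec_; ¬?; dec-true; dec-no; decidable-stable)
open import Relation.Unary using (Decidable)

⟦_⟧ : {A : Set} → Dec A → ℕ
⟦ a? ⟧ = if does a? then 1 else 0

⟦⟧-mono : {A B : Set} → (A → B) → (a? : Dec A) (b? : Dec B) → ⟦ a? ⟧ ≤ ⟦ b? ⟧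
⟦⟧-mono A→B (yes a) (yes _) = ≤-refl
⟦⟧-mono A→B (yes a) (no ¬b) = ⊥-elim (¬b (A→B a))
⟦⟧-mono A→B (no _)  _       = z≤n

⟦⟧-split : {A B : Set} (a? : Dec A) (b? : Dec B) → ⟦ b? ⟧ ≡ ⟦ a? ×-dec b? ⟧ + ⟦ ¬? a? ×-dec b? ⟧
⟦⟧-split (yes _) (yes _) = refl
⟦⟧-split (yes _) (no _)  = refl
⟦⟧-split (no _)  (yes _) = refl
⟦⟧-split (no _)  (no _)  = refl

∑ : ∀ {k} → (Fin k → ℕ) → ℕ
∑ {zero}  f = 0
∑ {suc k} f = f zero + ∑ (λ i → f (suc i))

∑-cong : ∀ {k} {f g : Fin k → ℕ} → (∀ i → f i ≡ g i) → ∑ f ≡ ∑ g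
∑-cong {zero}  f≡g = refl
∑-cong {suc k} f≡g = cong₂ _+_ (f≡g zero) (∑-cong (λ i → f≡g (suc i)))

∑-mono : ∀ {k} {f g : Fin k → ℕ} → (∀ i → f i ≤ g i) → ∑ f ≤ ∑ g
∑-mono {zero}  f≤g = z≤n
∑-mono {suc k} f≤g = +-mono-≤ (f≤g zero) (∑-mono (λ i → f≤g (suc i)))

∑-+ : ∀ {k} (f g : Fin k → ℕ) → ∑ (λ i → f i + g i) ≡ ∑ f + ∑ g
∑-+ {zero}  f g = refl
∑-+ {suc k} f g = begin
  (f zero + g zero) + ∑ (λ i → f (suc i) + g (suc i))
    ≡⟨ cong ((f zero + g zero) +_) (∑-+ (λ i → f (suc i)) (λ i → g (suc i))) ⟩
  (f zero + g zero) + (∑ (λ i → f (suc i)) + ∑ (λ i → g (suc i)))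
    ≡⟨ interchange +-commutativeSemigroup (f zero) (g zero) _ _ ⟩
  (f zero + ∑ (λ i → f (suc i))) + (g zero + ∑ (λ i → g (suc i))) ∎
  where open ≡-Reasoning

∑-zero : ∀ k → ∑ {k} (λ _ → 0) ≡ 0
∑-zero zero    = refl
∑-zero (suc k) = ∑-zero k

count : ∀ {n} {P : Fin n → Set} → Decidable P → ℕ
count P? = ∑ (λ x → ⟦ P? x ⟧)

count-all : ∀ n → count {n} (λ _ → yes tt) ≡ n
count-all zero    = refl
count-all (suc n) = cong suc (count-all n)

count-mono : ∀ {n} {P Q : Fin n → Set} (P? : Decidable P) (Q? : Decidable Q) →
             (∀ x → P x → Q x) → count P? ≤ count Q?
count-mono P? Q? P⊆Q = ∑-mono (λ x → ⟦⟧-mono (P⊆Q x) (P? x) (Q? x))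

count-cong : ∀ {n} {P Q : Fin n → Set} (P? : Decidable P) (Q? : Decidable Q) →
             (∀ x → P x → Q x) → (∀ x → Q x → P x) → count P? ≡ count Q?
count-cong P? Q? P⊆Q Q⊆P = ≤-antisym (count-mono P? Q? P⊆Q) (count-mono Q? P? Q⊆P)

count-split : ∀ {n} {P Q : Fin n → Set} (P? : Decidable P) (Q? : Decidable Q) →
              count Q? ≡ count (λ x → P? x ×-dec Q? x) + count (λ x → ¬? (P? x) ×-dec Q? x)
count-split P? Q? = trans (∑-cong (λ x → ⟦⟧-split (P? x) (Q? x)))
                          (∑-+ (λ x → ⟦ P? x ×-dec Q? x ⟧) (λ x → ⟦ ¬? (P? x) ×-dec Q? x ⟧))

count-pos : ∀ {n} {P : Fin n → Set} (P? : Decidable P) {a : Fin n} → P a → 0 < count P?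
count-pos P? {zero} Pa with P? zero
... | yes _  = s≤s z≤n
... | no ¬Pa = ⊥-elim (¬Pa Pa)
count-pos P? {suc a} Pa = ≤-trans (count-pos (λ x → P? (suc x)) Pa) (m≤n+m _ ⟦ P? zero ⟧)

count-strict : ∀ {n} {P Q : Fin n → Set} (P? : Decidable P) (Q? : Decidable Q) →
               (∀ x → P x → Q x) → ∀ {a} → Q a → ¬ P a → count P? < count Q?
count-strict P? Q? P⊆Q {a} Qa ¬Pa = begin-strict
  count P?
    ≡⟨ count-cong P? (λ x → P? x ×-dec Q? x) (λ x p → p , P⊆Q x p) (λ x → proj₁) ⟩
  count (λ x → P? x ×-dec Q? x)
    <⟨ m<m+n _ (count-pos (λ x → ¬? (P? x) ×-dec Q? x) (¬Pa , Qa)) ⟩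
  count (λ x → P? x ×-dec Q? x) + count (λ x → ¬? (P? x) ×-dec Q? x)
    ≡⟨ count-split P? Q? ⟨
  count Q? ∎
  where open ≤-Reasoning

count-inj : ∀ {a b} {P : Fin a → Set} {Q : Fin b → Set} (P? : Decidable P) (Q? : Decidable Q)
            (f : ∀ x → P x → Fin b) → (∀ x p → Q (f x p)) →
            (∀ x y p q → f x p ≡ f y q → x ≡ y) → count P? ≤ count Q?
count-inj {zero}  P? Q? f into inj = z≤n
count-inj {suc a} {Q = Q} P? Q? f into inj with P? zero
... | no _ = count-inj (λ x → P? (suc x)) Q? (λ x → f (suc x)) (λ x → into (suc x))
                       (λ x y p q e → Fin.suc-injective (inj (suc x) (suc y) p q e))
... | yes p₀ = begin
  suc (count (λ x → P? (suc x)))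
    ≤⟨ s≤s (count-inj (λ x → P? (suc x)) Q-rest? (λ x → f (suc x)) into-rest inj-rest) ⟩
  suc (count Q-rest?)
    ≤⟨ count-strict Q-rest? Q? (λ _ → proj₁) (into zero p₀) (λ q → proj₂ q refl) ⟩
  count Q? ∎
  where
  open ≤-Reasoning
  -- the remaining elements of P map injectively into Q without f zero
  Q-rest? : Decidable (λ s → Q s × s ≢ f zero p₀)
  Q-rest? s = Q? s ×-dec ¬? (s ≟ f zero p₀)
  into-rest : ∀ x p → Q (f (suc x) p) × f (suc x) p ≢ f zero p₀
  into-rest x p = into (suc x) p , λ e → Fin.0≢1+n (sym (inj (suc x) zero p p₀ e))
  inj-rest : ∀ x y p q → f (suc x) p ≡ f (suc y) q → x ≡ y
  inj-rest x y p q e = Fin.suc-injective (inj (suc x) (suc y) p q e)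

count-subsingleton : ∀ {n} {P : Fin n → Set} (P? : Decidable P) →
                     (∀ {x y} → P x → P y → x ≡ y) → ∀ {a} → P a → count P? ≡ 1
count-subsingleton P? unique Pa = ≤-antisym
  (count-inj P? (λ (_ : Fin 1) → yes tt) (λ _ _ → zero) (λ _ _ → tt) (λ _ _ p q _ → unique p q))
  (count-pos P? Pa)

count-complement : ∀ {n} (a : Fin n) → suc (count (λ x → ¬? (x ≟ a))) ≡ n
count-complement {n} a = begin
  suc (count (λ x → ¬? (x ≟ a)))
    ≡⟨ cong₂ _+_ (count-subsingleton (λ x → (x ≟ a) ×-dec yes tt) (λ p q → trans (proj₁ p) (sym (proj₁ q))) (refl , tt))
                  (count-cong (λ x → ¬? (x ≟ a) ×-dec yes tt) (λ x → ¬? (x ≟ a)) (λ _ → proj₁) (λ _ p → p , tt)) ⟨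
  count (λ x → (x ≟ a) ×-dec yes tt) + count (λ x → ¬? (x ≟ a) ×-dec yes tt)
    ≡⟨ count-split (λ x → x ≟ a) (λ _ → yes tt) ⟨
  count {n} (λ _ → yes tt)
    ≡⟨ count-all n ⟩
  n ∎
  where open ≡-Reasoning

count-onto : ∀ {n} {P : Fin n → Set} (P? : Decidable P) (f : Fin n → ℕ) →
             (∀ x → P x → f x < count P?) → (∀ x y → P x → P y → f x ≡ f y → x ≡ y) →
             ∀ {t} → t < count P? → ∃ λ x → P x × f x ≡ t
count-onto {P = P} P? f bounded inj {t} t<c with any? (λ x → P? x ×-dec (f x ℕ.≟ t))
... | yes hit  = hit
... | no  miss = ⊥-elim (<-irrefl refl (begin-strict
  count P?
    ≤⟨ count-inj P? (λ s → ¬? (s ≟ target)) asFin asFin≢target (λ x y p q e → inj x y p q (asFin-injective x y p q e)) ⟩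
  count (λ s → ¬? (s ≟ target))
    <⟨ ≤-reflexive (count-complement target) ⟩
  count P? ∎))
  where
  open ≤-Reasoning
  target : Fin (count P?)
  target = fromℕ< t<c
  asFin : ∀ x → P x → Fin (count P?)
  asFin x p = fromℕ< (bounded x p)
  -- if t is never hit, f maps P injectively into Fin (count P) without target
  asFin≢target : ∀ x p → asFin x p ≢ target
  asFin≢target x p e = miss (x , p , trans (sym (toℕ-fromℕ< _)) (trans (cong toℕ e) (toℕ-fromℕ< t<c)))
  asFin-injective : ∀ x y p q → asFin x p ≡ asFin y q → f x ≡ f y
  asFin-injective _ _ _ _ e = trans (sym (toℕ-fromℕ< _)) (trans (cong toℕ e) (toℕ-fromℕ< _))

∑-classes : ∀ {n k} (c : Fin n → Fin k) → ∑ (λ i → count (λ u → c u ≟ i)) ≡ n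
∑-classes {zero}  {k} c = ∑-zero k
∑-classes {suc n} c = begin
  ∑ (λ i → ⟦ c zero ≟ i ⟧ + count (λ u → c (suc u) ≟ i))
    ≡⟨ ∑-+ (λ i → ⟦ c zero ≟ i ⟧) (λ i → count (λ u → c (suc u) ≟ i)) ⟩
  count (λ i → c zero ≟ i) + ∑ (λ i → count (λ u → c (suc u) ≟ i))
    ≡⟨ cong₂ _+_ (count-subsingleton (λ i → c zero ≟ i) (λ p q → trans (sym p) q) refl)
                 (∑-classes (λ u → c (suc u))) ⟩
  suc n ∎
  where open ≡-Reasoning

-- least P? is the index of the first element satisfying P (it is n if there is none);
-- it serves as a canonical representative of an equivalence class.
least : ∀ {n} {P : Fin n → Set} → Decidable P → ℕ
least {zero}  P? = 0
least {suc n} P? = if does (P? zero) then 0 else suc (least (λ x → P? (suc x)))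

least-spec : ∀ {n} {P : Fin n → Set} (P? : Decidable P) {a} → P a → ∃ λ j → toℕ j ≡ least P? × P j
least-spec {suc n} P? Pa with P? zero
... | yes P0 = zero , refl , P0
least-spec {suc n} P? {zero}  Pa | no ¬P0 = ⊥-elim (¬P0 Pa)
least-spec {suc n} P? {suc a} Pa | no _ with least-spec (λ x → P? (suc x)) Pa
... | j , j≡ , Pj = suc j , cong suc j≡ , Pj

least-cong : ∀ {n} {P Q : Fin n → Set} (P? : Decidable P) (Q? : Decidable Q) →
             (∀ x → P x → Q x) → (∀ x → Q x → P x) → least P? ≡ least Q?
least-cong {zero}  P? Q? P⊆Q Q⊆P = refl
least-cong {suc n} P? Q? P⊆Q Q⊆P with P? zero | Q? zero
... | yes _ | yes _  = refl
... | no _  | no _   = cong suc (least-cong (λ x → P? (suc x)) (λ x → Q? (suc x))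
                                            (λ x → P⊆Q (suc x)) (λ x → Q⊆P (suc x)))
... | yes p | no ¬q  = ⊥-elim (¬q (P⊆Q zero p))
... | no ¬p | yes q  = ⊥-elim (¬p (Q⊆P zero q))

-- Subsets of Fin n cut out by decidable predicates, with their membership and
-- cardinality; the colour classes of Defs are of this form.
⟪_⟫ : ∀ {n} {P : Fin n → Set} → Decidable P → Subset n
⟪ P? ⟫ = tabulate (λ x → does (P? x))

∈⟪⟫⁺ : ∀ {n} {P : Fin n → Set} (P? : Decidable P) {x} → P x → x ∈ ⟪ P? ⟫
∈⟪⟫⁺ P? {x} Px = lookup⇒[]= x ⟪ P? ⟫ (trans (lookup∘tabulate _ x) (dec-true (P? x) Px))

∈⟪⟫⁻ : ∀ {n} {P : Fin n → Set} (P? : Decidable P) {x} → x ∈ ⟪ P? ⟫ → P x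
∈⟪⟫⁻ P? {x} x∈ = true⇒ (P? x) (trans (sym (lookup∘tabulate _ x)) ([]=⇒lookup x∈))
  where
  true⇒ : {A : Set} (a? : Dec A) → does a? ≡ true → A
  true⇒ (yes a) _  = a
  true⇒ (no _)  ()

∣⟪⟫∣ : ∀ {n} {P : Fin n → Set} (P? : Decidable P) → ∣ ⟪ P? ⟫ ∣ ≡ count P?
∣⟪⟫∣ {zero}  P? = refl
∣⟪⟫∣ {suc n} P? with P? zero
... | yes _ = cong suc (∣⟪⟫∣ (λ x → P? (suc x)))
... | no _  = ∣⟪⟫∣ (λ x → P? (suc x))

∣∣≡count : ∀ {n} (S : Subset n) → ∣ S ∣ ≡ count (_∈? S)
∣∣≡count []            = refl
∣∣≡count (true  ∷ S) = cong suc (∣∣≡count S)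
∣∣≡count (false ∷ S) = ∣∣≡count S

≤-quotient : ∀ {x q d} .{{_ : NonZero d}} → q * d ≤ x → q ≤ x / d
≤-quotient {x} {q} {d} qd≤x = begin
  q         ≡⟨ m*n/n≡m q d ⟨
  q * d / d ≤⟨ /-monoˡ-≤ d qd≤x ⟩
  x / d     ∎
  where open ≤-Reasoning

quotient-unique : ∀ {x q d} .{{_ : NonZero d}} → q * d ≤ x → x < suc q * d → x / d ≡ q
quotient-unique lo hi = ≤-antisym (m<1+n⇒m≤n (m<n*o⇒m/o<n hi)) (≤-quotient lo)

⌊⌋≤⌈⌉ : ∀ n k → ⌊ n / k ⌋ ≤ ⌈ n / k ⌉
⌊⌋≤⌈⌉ n zero    = z≤n
⌊⌋≤⌈⌉ n (suc k) = /-monoˡ-≤ (suc k) (m≤m+n n k)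

⌈⌉≤⌊⌋+1 : ∀ n k → ⌈ n / k ⌉ ≤ ⌊ n / k ⌋ + 1
⌈⌉≤⌊⌋+1 n zero    = z≤n
⌈⌉≤⌊⌋+1 n (suc k) = begin
  (n + k) / suc k               ≤⟨ /-monoˡ-≤ (suc k) (+-monoʳ-≤ n (n≤1+n k)) ⟩
  (n + suc k) / suc k           ≡⟨ m/n≡1+[m∸n]/n (m≤n+m (suc k) n) ⟩
  1 + (n + suc k ∸ suc k) / suc k ≡⟨ cong (λ z → 1 + z / suc k) (m+n∸n≡m n (suc k)) ⟩
  1 + n / suc k                 ≡⟨ +-comm 1 _ ⟩
  n / suc k + 1                 ∎
  where open ≤-Reasoning

floorCeil-exact : ∀ {n k a} → n ≡ a * suc k → ⌊ n / suc k ⌋ ≡ a × ⌈ n / suc k ⌉ ≡ a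
floorCeil-exact {k = k} {a} refl =
  quotient-unique ≤-refl (m<n+m (a * suc k) z<s) ,
  quotient-unique (m≤m+n (a * suc k) k) (begin-strict
    a * suc k + k     <⟨ +-monoʳ-< (a * suc k) (n<1+n k) ⟩
    a * suc k + suc k ≡⟨ +-comm (a * suc k) (suc k) ⟩
    suc a * suc k     ∎)
  where open ≤-Reasoning

floorCeil-between : ∀ {n k a} → a * suc k < n → n < suc a * suc k →
                    ⌊ n / suc k ⌋ ≡ a × ⌈ n / suc k ⌉ ≡ suc a
floorCeil-between {n} {k} {a} lo hi = quotient-unique (<⇒≤ lo) hi , quotient-unique lo′ hi′
  where
  open ≤-Reasoning
  lo′ : suc a * suc k ≤ n + k
  lo′ = begin
    suc a * suc k       ≡⟨ +-comm (suc k) (a * suc k) ⟩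
    a * suc k + suc k   ≡⟨ +-suc (a * suc k) k ⟩
    suc (a * suc k) + k ≤⟨ +-monoˡ-≤ k lo ⟩
    n + k               ∎
  hi′ : n + k < suc (suc a) * suc k
  hi′ = begin-strict
    n + k                 <⟨ +-monoʳ-< n (n<1+n k) ⟩
    n + suc k             ≤⟨ +-monoˡ-≤ (suc k) (<⇒≤ hi) ⟩
    suc a * suc k + suc k ≡⟨ +-comm (suc a * suc k) (suc k) ⟩
    suc (suc a) * suc k   ∎

squeeze : ∀ {a s b} → a ≤ s → s ≤ b → b ≤ a + 1 → s ≡ a ⊎ s ≡ b
squeeze {a} {s} a≤s s≤b b≤a+1 with m≤n⇒m<n∨m≡n a≤s
... | inj₂ a≡s = inj₁ (sym a≡s)
... | inj₁ a<s = inj₂ (≤-antisym s≤b (≤-trans b≤a+1 (subst (_≤ s) (+-comm 1 a) a<s)))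

balanced : ∀ {a b s t} → a ≤ b → b ≤ a + 1 → s ≡ a ⊎ s ≡ b → t ≡ a ⊎ t ≡ b → s ≤ t + 1
balanced {a} {b} a≤b b≤a+1 s∈ t∈ = ≤-trans (s≤b s∈) (≤-trans b≤a+1 (+-monoˡ-≤ 1 (a≤t t∈)))
  where
  s≤b : ∀ {s} → s ≡ a ⊎ s ≡ b → s ≤ b
  s≤b (inj₁ refl) = a≤b
  s≤b (inj₂ refl) = ≤-refl
  a≤t : ∀ {t} → t ≡ a ⊎ t ≡ b → a ≤ t
  a≤t (inj₁ refl) = ≤-refl
  a≤t (inj₂ refl) = a≤b

k*2≡k+k : ∀ k → k * 2 ≡ k + k
k*2≡k+k k = trans (*-comm k 2) (cong (k +_) (+-identityʳ k))

ceilHalf≤ : ∀ n k → n + 1 ≤ k + k → ⌈ (n + 1) / 2 ⌉ ≤ k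
ceilHalf≤ n k h = m<1+n⇒m≤n (m<n*o⇒m/o<n (begin-strict
  n + 1 + 1     ≤⟨ +-monoˡ-≤ 1 h ⟩
  k + k + 1     ≡⟨ +-comm (k + k) 1 ⟩
  suc (k + k)   <⟨ n<1+n _ ⟩
  2 + (k + k)   ≡⟨ cong (2 +_) (k*2≡k+k k) ⟨
  suc k * 2     ∎))
  where open ≤-Reasoning

ceilHalf≥ : ∀ n k → ⌈ (n + 1) / 2 ⌉ ≤ k → n + 1 ≤ k + k
ceilHalf≥ n k c≤k with n + 1 ≤? k + k
... | yes h = h
... | no ¬h = ⊥-elim (<-irrefl refl (≤-trans (≤-quotient 2k+2≤) c≤k))
  where
  open ≤-Reasoning
  2k+2≤ : suc k * 2 ≤ n + 1 + 1
  2k+2≤ = begin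
    2 + k * 2     ≡⟨ cong (2 +_) (k*2≡k+k k) ⟩
    2 + (k + k)   ≤⟨ s≤s (≰⇒> ¬h) ⟩
    suc (n + 1)   ≡⟨ +-comm 1 (n + 1) ⟩
    n + 1 + 1     ∎

double-positive : ∀ {n x} → suc n ≤ x + x → 0 < x
double-positive {x = suc x} _ = z<s

residue-cases : ∀ {x m} .{{_ : NonZero m}} → x < m + m → x ≡ x % m ⊎ x ≡ x % m + m
residue-cases {x} {m} x<2m with x / m | m≡m%n+[m/n]*n x m
                              | m<n*o⇒m/o<n {x} {2} {m} (subst (x <_) (cong (m +_) (sym (+-identityʳ m))) x<2m)
... | 0           | x≡ | _ = inj₁ (trans x≡ (+-identityʳ _))
... | 1           | x≡ | _ = inj₂ (trans x≡ (cong (x % m +_) (+-identityʳ m)))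
... | suc (suc _) | _  | s≤s (s≤s ())

residues-differ : ∀ {a b m} .{{_ : NonZero m}} → a < b → b < a + m → b < m + m → a % m ≢ b % m
residues-differ {a} {b} {m} a<b b<a+m b<2m e
  with residue-cases {a} (<-trans a<b b<2m) | residue-cases {b} b<2m
... | inj₁ a≡ | inj₁ b≡ = <-irrefl (trans a≡ (trans e (sym b≡))) a<b
... | inj₁ a≡ | inj₂ b≡ = <-irrefl (trans b≡ (cong (_+ m) (trans (sym e) (sym a≡)))) b<a+m
... | inj₂ a≡ | inj₁ b≡ = <-asym a<b (begin-strict
  b         ≡⟨ trans b≡ (sym e) ⟩
  a % m     <⟨ m<m+n (a % m) (>-nonZero⁻¹ m) ⟩
  a % m + m ≡⟨ a≡ ⟨
  a         ∎)
  where open ≤-Reasoning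
... | inj₂ a≡ | inj₂ b≡ = <-irrefl (trans a≡ (trans (cong (_+ m) e) (sym b≡))) a<b

-- If f is injective on P, all f-values on P have residue j mod m and lie below
-- q·m, then P has at most q elements (f x is determined by its quotient by m).
residueClass≤ : ∀ {n m q j} .{{_ : NonZero m}} {P : Fin n → Set} (P? : Decidable P) (f : Fin n → ℕ) →
                (∀ x y → P x → P y → f x ≡ f y → x ≡ y) →
                (∀ x → P x → f x % m ≡ j) → (∀ x → P x → f x < q * m) → count P? ≤ q
residueClass≤ {m = m} {q} {P = P} P? f inj residue bound =
  ≤-trans (count-inj P? (λ (_ : Fin q) → yes tt) quotient (λ _ _ → tt) quotient-inj) (≤-reflexive (count-all q))
  where
  quotient : ∀ x → P x → Fin q
  quotient x p = fromℕ< (m<n*o⇒m/o<n (bound x p))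
  quotient-inj : ∀ x y p p′ → quotient x p ≡ quotient y p′ → x ≡ y
  quotient-inj x y p p′ e = inj x y p p′ (begin
    f x                   ≡⟨ m≡m%n+[m/n]*n (f x) m ⟩
    f x % m + f x / m * m ≡⟨ cong₂ (λ r s → r + s * m) (trans (residue x p) (sym (residue y p′))) quotients≡ ⟩
    f y % m + f y / m * m ≡⟨ m≡m%n+[m/n]*n (f y) m ⟨
    f y                   ∎)
    where
    open ≡-Reasoning
    quotients≡ : f x / m ≡ f y / m
    quotients≡ = trans (sym (toℕ-fromℕ< _)) (trans (cong toℕ e) (toℕ-fromℕ< _))

module _ {n : ℕ} (G : Graph n) where

  Edge-sym : ∀ {u w} → Edge G u w → Edge G w u
  Edge-sym {u} {w} uw = trans (sym (Graph.sym G u w)) uw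

  Edge-irrefl : ∀ {u} → ¬ Edge G u u
  Edge-irrefl {u} uu with trans (sym uu) (Graph.irrefl G u)
  ... | ()

  Edge⇒≢ : ∀ {u w} → Edge G u w → u ≢ w
  Edge⇒≢ uw refl = Edge-irrefl uw

  Edge? : ∀ u w → Dec (Edge G u w)
  Edge? u w = Graph.adj G u w Bool.≟ true

  Dominates : Fin n → Set
  Dominates v = ∀ w → w ≢ v → Edge G v w

  -- If every independent set through v has at most one vertex, v dominates:
  -- a non-neighbour w would give the independent set {v, w}.
  α≤1⇒dominates : ∀ {v} → (∀ S → IsIndependent G S → v ∈ S → ∣ S ∣ ≤ 1) → Dominates v
  α≤1⇒dominates {v} α≤1 w w≢v with Edge? v w
  ... | yes vw = vw
  ... | no ¬vw = ⊥-elim (<-irrefl refl (≤-trans two≤∣S∣ (α≤1 S independent (∈⟪⟫⁺ pair? (inj₁ refl)))))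
    where
    pair? : Decidable (λ t → t ≡ v ⊎ t ≡ w)
    pair? t = (t ≟ v) ⊎-dec (t ≟ w)
    S : Subset n
    S = ⟪ pair? ⟫
    nonAdjacent : ∀ {a b} → a ≡ v ⊎ a ≡ w → b ≡ v ⊎ b ≡ w → ¬ Edge G a b
    nonAdjacent (inj₁ refl) (inj₁ refl) = Edge-irrefl
    nonAdjacent (inj₂ refl) (inj₂ refl) = Edge-irrefl
    nonAdjacent (inj₁ refl) (inj₂ refl) = ¬vw
    nonAdjacent (inj₂ refl) (inj₁ refl) = ¬vw ∘ Edge-sym
    independent : IsIndependent G S
    independent a b a∈S b∈S = nonAdjacent (∈⟪⟫⁻ pair? a∈S) (∈⟪⟫⁻ pair? b∈S)
    two≤∣S∣ : 2 ≤ ∣ S ∣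
    two≤∣S∣ = subst (2 ≤_) (sym (∣⟪⟫∣ pair?))
      (≤-trans (s≤s (count-pos (λ t → t ≟ v) refl))
               (count-strict (λ t → t ≟ v) pair? (λ _ → inj₁) (inj₂ refl) w≢v))

  _▷_ : ∀ {P u x w} → Walk G P u x → Walk G P x w → Walk G P u w
  here           ▷ q = q
  step ux Px p   ▷ q = step ux Px (p ▷ q)

  viaHub : ∀ {v} → Dominates v → (P : Fin n → Set) → P v → ∀ u w → P w → Walk G P u w
  viaHub {v} dom P Pv u w Pw with u ≟ v | w ≟ v
  ... | yes refl | yes refl = here
  ... | yes refl | no w≢v  = step (dom w w≢v) Pw here
  ... | no u≢v  | yes refl = step (Edge-sym (dom u u≢v)) Pv here
  ... | no u≢v  | no w≢v  = step (Edge-sym (dom u u≢v)) Pv (step (dom w w≢v) Pw here)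

  -- A vertex set containing a dominating vertex v is non-separable as soon as it
  -- stays connected after deleting v (deleting any other vertex keeps the hub v).
  hubNonSeparable : ∀ {v S} → Dominates v → v ∈ S → Connected G (λ x → x ∈ S × x ≢ v) → NonSeparable G S
  hubNonSeparable {v} {S} dom v∈S connected-v = (λ u w _ → viaHub dom (_∈ S) v∈S u w) , separate
    where
    separate : ∀ t → t ∈ S → Connected G (λ x → x ∈ S × x ≢ t)
    separate t _ with t ≟ v
    ... | yes refl = connected-v
    ... | no t≢v   = λ u w _ → viaHub dom (λ x → x ∈ S × x ≢ t) (v∈S , λ v≡t → t≢v (sym v≡t)) u w

  InSomeBlock : Subset n → Set
  InSomeBlock S = Σ (Subset n) λ B → IsBlock G B × S ⊆ B

  -- Every non-separable set lies in a block: enlarge it while possible, at most n times.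
  -- Maximality is not decidable, so the conclusion is double-negated; it is only
  -- used to refute a decidable statement.
  inBlock : ∀ S → NonSeparable G S → ¬ ¬ InSomeBlock S
  inBlock S = grow (n ∸ ∣ S ∣) S (m≤n+m∸n n ∣ S ∣)
    where
    outside : ∀ {B S} → ¬ (B ⊆ S) → ¬ ¬ (∃ λ x → x ∈ B × ¬ (x ∈ S))
    outside {B} {S} B⊈S noWitness = B⊈S (λ {x} x∈B → decidable-stable (x ∈? S) (λ x∉S → noWitness (x , x∈B , x∉S)))
    grow : ∀ k S → n ≤ ∣ S ∣ + k → NonSeparable G S → ¬ ¬ InSomeBlock S
    grow k S room nsS noBlock = ¬¬-excluded-middle λ where
        (no noExtension)    → noBlock (S , (nsS , maximal noExtension) , id)
        (yes (B , S⊂B , nsB)) → larger k room S⊂B nsB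
      where
      maximal : ¬ (∃ λ B → S ⊂ B × NonSeparable G B) → ∀ B → S ⊆ B → NonSeparable G B → B ⊆ S
      maximal noExtension B S⊆B nsB with B ⊆? S
      ... | yes B⊆S = B⊆S
      ... | no B⊈S  = ⊥-elim (outside B⊈S λ x∉S → noExtension (B , (S⊆B , x∉S) , nsB))
      larger : ∀ k → n ≤ ∣ S ∣ + k → ∀ {B} → S ⊂ B → NonSeparable G B → ⊥
      larger zero room {B} S⊂B _ =
        <-irrefl refl (≤-<-trans (≤-trans room (≤-reflexive (+-identityʳ _))) (<-≤-trans (p⊂q⇒∣p∣<∣q∣ S⊂B) (∣p∣≤n B)))
      larger (suc k) room {B} S⊂B nsB =
        grow k B (≤-trans room (≤-trans (≤-reflexive (+-suc _ k)) (+-monoˡ-≤ k (p⊂q⇒∣p∣<∣q∣ S⊂B)))) nsB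
             (λ (B′ , blockB′ , B⊆B′) → noBlock (B′ , blockB′ , B⊆B′ ∘ proj₁ S⊂B))

  -- In a block graph with a dominating vertex v, adjacency among the other vertices
  -- is transitive: for a path x − y − z, the set {v, x, y, z} is non-separable,
  -- so it lies in a block, which is a clique.
  blockGraph-transitive : IsBlockGraph G → ∀ {v} → Dominates v → ∀ {x y z} → x ≢ v → y ≢ v → z ≢ v →
                          Edge G x y → Edge G y z → x ≢ z → Edge G x z
  blockGraph-transitive blockGraph {v} dom {x} {y} {z} x≢v y≢v z≢v xy yz x≢z with Edge? x z
  ... | yes xz = xz
  ... | no ¬xz = ⊥-elim (inBlock S (hubNonSeparable dom (∈S (inj₁ refl)) (λ a b Qa Qb → toY Qa ▷ fromY Qb))
                                 λ (B , block , S⊆B) → ¬xz (blockGraph B block x z (S⊆B x∈S) (S⊆B z∈S) x≢z))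
    where
    S? : Decidable (λ t → t ≡ v ⊎ t ≡ x ⊎ t ≡ y ⊎ t ≡ z)
    S? t = (t ≟ v) ⊎-dec (t ≟ x) ⊎-dec (t ≟ y) ⊎-dec (t ≟ z)
    S : Subset n
    S = ⟪ S? ⟫
    ∈S : ∀ {t} → t ≡ v ⊎ t ≡ x ⊎ t ≡ y ⊎ t ≡ z → t ∈ S
    ∈S = ∈⟪⟫⁺ S?
    x∈S : x ∈ S
    x∈S = ∈S (inj₂ (inj₁ refl))
    z∈S : z ∈ S
    z∈S = ∈S (inj₂ (inj₂ (inj₂ refl)))
    Q : Fin n → Set
    Q t = t ∈ S × t ≢ v
    Qy : Q y
    Qy = ∈S (inj₂ (inj₂ (inj₁ refl))) , y≢v
    toY : ∀ {t} → Q t → Walk G Q t y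
    toY (t∈S , t≢v) with ∈⟪⟫⁻ S? t∈S
    ... | inj₁ t≡v                 = ⊥-elim (t≢v t≡v)
    ... | inj₂ (inj₁ refl)         = step xy Qy here
    ... | inj₂ (inj₂ (inj₁ refl))  = here
    ... | inj₂ (inj₂ (inj₂ refl))  = step (Edge-sym yz) Qy here
    fromY : ∀ {t} → Q t → Walk G Q y t
    fromY Qt@(t∈S , t≢v) with ∈⟪⟫⁻ S? t∈S
    ... | inj₁ t≡v                 = ⊥-elim (t≢v t≡v)
    ... | inj₂ (inj₁ refl)         = step (Edge-sym xy) Qt here
    ... | inj₂ (inj₂ (inj₁ refl))  = here
    ... | inj₂ (inj₂ (inj₂ refl))  = step yz Qt here

-- Given a labelling of Fin n, the key κ x = toℕ x + label x · n orders
-- the elements label by label (by index within a label); κ is injective, and a key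
-- between two keys of the same label carries that label.
module Key {n : ℕ} .{{_ : NonZero n}} (label : Fin n → ℕ) where

  κ : Fin n → ℕ
  κ x = toℕ x + label x * n

  κ/n : ∀ x → κ x / n ≡ label x
  κ/n x = quotient-unique (m≤n+m (label x * n) (toℕ x)) (+-monoˡ-< (label x * n) (toℕ<n x))

  κ-injective : ∀ {x y} → κ x ≡ κ y → x ≡ y
  κ-injective {x} {y} κx≡κy = toℕ-injective (begin
    toℕ x     ≡⟨ m<n⇒m%n≡m (toℕ<n x) ⟨
    toℕ x % n ≡⟨ [m+kn]%n≡m%n (toℕ x) (label x) n ⟨
    κ x % n   ≡⟨ cong (_% n) κx≡κy ⟩
    κ y % n   ≡⟨ [m+kn]%n≡m%n (toℕ y) (label y) n ⟩
    toℕ y % n ≡⟨ m<n⇒m%n≡m (toℕ<n y) ⟩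
    toℕ y     ∎)
    where open ≡-Reasoning

  κ-between : ∀ {x y z} → label x ≡ label y → κ x ≤ κ z → κ z ≤ κ y → label z ≡ label x
  κ-between {x} {y} {z} same x≤z z≤y = ≤-antisym
    (begin label z ≡⟨ κ/n z ⟨ κ z / n ≤⟨ /-monoˡ-≤ n z≤y ⟩ κ y / n ≡⟨ κ/n y ⟩ label y ≡⟨ same ⟨ label x ∎)
    (begin label x ≡⟨ κ/n x ⟨ κ x / n ≤⟨ /-monoˡ-≤ n x≤z ⟩ κ z / n ≡⟨ κ/n z ⟩ label z ∎)
    where open ≤-Reasoning

module Rank {n : ℕ} {A : Fin n → Set} (A? : Decidable A)
            (κ : Fin n → ℕ) (κ-injective : ∀ {x y} → κ x ≡ κ y → x ≡ y) where

  below? : (u : Fin n) → Decidable (λ x → A x × κ x < κ u)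
  below? u x = A? x ×-dec (κ x <? κ u)

  rank : Fin n → ℕ
  rank u = count (below? u)

  rank-mono : ∀ {u w} → A u → κ u < κ w → rank u < rank w
  rank-mono {u} {w} Au u<w = count-strict (below? u) (below? w) (λ x (Ax , x<u) → Ax , <-trans x<u u<w)
                                          (Au , u<w) (λ (_ , u<u) → <-irrefl refl u<u)

  rank-injective : ∀ {u w} → A u → A w → rank u ≡ rank w → u ≡ w
  rank-injective {u} {w} Au Aw same with <-cmp (κ u) (κ w)
  ... | tri< u<w _ _ = ⊥-elim (<-irrefl same (rank-mono Au u<w))
  ... | tri≈ _ u≡w _ = κ-injective u≡w
  ... | tri> _ _ w<u = ⊥-elim (<-irrefl (sym same) (rank-mono Aw w<u))

  rank⇒κ : ∀ {u w} → A w → rank u < rank w → κ u < κ w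
  rank⇒κ {u} {w} Aw r< with <-cmp (κ u) (κ w)
  ... | tri< u<w _ _ = u<w
  ... | tri≈ _ u≡w _ = ⊥-elim (<-irrefl (cong rank (κ-injective u≡w)) r<)
  ... | tri> _ _ w<u = ⊥-elim (<-asym r< (rank-mono Aw w<u))

  rank-bounded : ∀ {u} → A u → rank u < count A?
  rank-bounded {u} Au = count-strict (below? u) A? (λ _ → proj₁) Au (λ (_ , u<u) → <-irrefl refl u<u)

  rank-onto : ∀ {t} → t < count A? → ∃ λ u → A u × rank u ≡ t
  rank-onto = count-onto A? rank (λ _ → rank-bounded) (λ _ _ → rank-injective)

  between? : (u w : Fin n) → Decidable (λ x → A x × κ u ≤ κ x × κ x < κ w)
  between? u w x = A? x ×-dec (κ u ≤? κ x) ×-dec (κ x <? κ w)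

  rank-gap : ∀ {u w} → κ u < κ w → rank w ≡ rank u + count (between? u w)
  rank-gap {u} {w} u<w = trans (count-split (λ x → κ x <? κ u) (below? w)) (cong₂ _+_
    (count-cong (λ x → (κ x <? κ u) ×-dec below? w x) (below? u)
                (λ x (x<u , Ax , _) → Ax , x<u) (λ x (Ax , x<u) → x<u , Ax , <-trans x<u u<w))
    (count-cong (λ x → ¬? (κ x <? κ u) ×-dec below? w x) (between? u w)
                (λ x (x≮u , Ax , x<w) → Ax , ≮⇒≥ x≮u , x<w) (λ x (Ax , u≤x , x<w) → ≤⇒≯ u≤x , Ax , x<w)))

record Enumeration {N : ℕ} (G : Graph (suc N)) (v : Fin (suc N)) (m : ℕ) : Set where
  field
    pos           : Fin (suc N) → ℕ
    pos-injective : ∀ {u w} → u ≢ v → w ≢ v → pos u ≡ pos w → u ≡ w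
    pos-bounded   : ∀ {u} → u ≢ v → pos u < N
    pos-onto      : ∀ {t} → t < N → ∃ λ u → u ≢ v × pos u ≡ t
    pos-spread    : ∀ {u w} → u ≢ v → w ≢ v → Edge G u w → pos u < pos w → pos w < pos u + m

-- For a block graph with dominating vertex v, the components of G − v are cliques.
-- Ranking the vertices ≠ v by the key whose label is the least vertex of their
-- component lists the components one after the other: an enumeration of spread ω.
module Components {N : ℕ} (G : Graph (suc N)) (blockGraph : IsBlockGraph G)
                  (v : Fin (suc N)) (dom : Dominates G v) where

  -- x and y lie in the same component of G − v (v forms a class by itself).
  _~_ : Fin (suc N) → Fin (suc N) → Set
  x ~ y = x ≡ y ⊎ (x ≢ v × y ≢ v × Edge G x y)

  _~?_ : ∀ x y → Dec (x ~ y)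
  x ~? y = (x ≟ y) ⊎-dec ¬? (x ≟ v) ×-dec ¬? (y ≟ v) ×-dec Edge? G x y

  ~-refl : ∀ {x} → x ~ x
  ~-refl = inj₁ refl

  ~-sym : ∀ {x y} → x ~ y → y ~ x
  ~-sym (inj₁ refl)              = inj₁ refl
  ~-sym (inj₂ (x≢v , y≢v , xy)) = inj₂ (y≢v , x≢v , Edge-sym G xy)

  ~-trans : ∀ {x y z} → x ~ y → y ~ z → x ~ z
  ~-trans (inj₁ refl) y~z = y~z
  ~-trans x~y (inj₁ refl) = x~y
  ~-trans {x} {y} {z} (inj₂ (x≢v , y≢v , xy)) (inj₂ (_ , z≢v , yz)) with x ≟ z
  ... | yes x≡z = inj₁ x≡z
  ... | no x≢z  = inj₂ (x≢v , z≢v , blockGraph-transitive G blockGraph dom x≢v y≢v z≢v xy yz x≢z)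

  ~⇒Edge : ∀ {x y} → x ~ y → x ≢ y → Edge G x y
  ~⇒Edge (inj₁ x≡y)          x≢y = ⊥-elim (x≢y x≡y)
  ~⇒Edge (inj₂ (_ , _ , xy)) _   = xy

  rep : Fin (suc N) → ℕ
  rep x = least (_~? x)

  rep-≡ : ∀ {x y} → x ~ y → rep x ≡ rep y
  rep-≡ {x} {y} x~y = least-cong (_~? x) (_~? y) (λ _ t~x → ~-trans t~x x~y) (λ _ t~y → ~-trans t~y (~-sym x~y))

  rep-≡⁻ : ∀ {x y} → rep x ≡ rep y → x ~ y
  rep-≡⁻ {x} {y} same with least-spec (_~? x) (~-refl {x}) | least-spec (_~? y) (~-refl {y})
  ... | j , j≡ , j~x | j′ , j′≡ , j′~y with toℕ-injective (trans j≡ (trans same (sym j′≡)))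
  ... | refl = ~-trans (~-sym j~x) j′~y

  component? : (u : Fin (suc N)) → Decidable (λ x → x ≢ v × x ~ u)
  component? u x = ¬? (x ≟ v) ×-dec (x ~? u)

  -- A component of G − v together with v is a clique, so it has fewer than ω vertices.
  component<ω : ∀ {ω} → (∀ S → IsClique G S → ∣ S ∣ ≤ ω) → ∀ u → count (component? u) < ω
  component<ω {ω} cliques u = begin-strict
    count (component? u) <⟨ count-strict (component? u) K? (λ _ → inj₂) (inj₁ refl) (λ (v≢v , _) → v≢v refl) ⟩
    count K?             ≡⟨ ∣⟪⟫∣ K? ⟨
    ∣ ⟪ K? ⟫ ∣           ≤⟨ cliques ⟪ K? ⟫ K-clique ⟩
    ω                    ∎
    where
    open ≤-Reasoning
    K? : Decidable (λ x → x ≡ v ⊎ (x ≢ v × x ~ u))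
    K? x = (x ≟ v) ⊎-dec component? u x
    adjacent : ∀ {a b} → a ≡ v ⊎ (a ≢ v × a ~ u) → b ≡ v ⊎ (b ≢ v × b ~ u) → a ≢ b → Edge G a b
    adjacent (inj₁ refl)          (inj₁ refl)          a≢b = ⊥-elim (a≢b refl)
    adjacent (inj₁ refl)          (inj₂ (b≢v , _))     _   = dom _ b≢v
    adjacent (inj₂ (a≢v , _))     (inj₁ refl)          _   = Edge-sym G (dom _ a≢v)
    adjacent (inj₂ (_ , a~u))     (inj₂ (_ , b~u))     a≢b = ~⇒Edge (~-trans a~u (~-sym b~u)) a≢b
    K-clique : IsClique G ⟪ K? ⟫
    K-clique a b a∈K b∈K = adjacent (∈⟪⟫⁻ K? a∈K) (∈⟪⟫⁻ K? b∈K)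

  open Key rep
  open Rank (λ x → ¬? (x ≟ v)) κ κ-injective

  others : count (λ x → ¬? (x ≟ v)) ≡ N
  others = suc-injective (count-complement v)

  -- Adjacent vertices u, w lie in one component; every vertex listed between
  -- them (including u, excluding w) belongs to it, so their positions are < ω apart.
  enumeration : ∀ {ω m} → (∀ S → IsClique G S → ∣ S ∣ ≤ ω) → ω ≤ m → Enumeration G v m
  enumeration {ω} {m} cliques ω≤m = record
    { pos           = rank
    ; pos-injective = rank-injective
    ; pos-bounded   = λ {u} u≢v → subst (rank u <_) others (rank-bounded u≢v)
    ; pos-onto      = λ {t} t<N → rank-onto (subst (t <_) (sym others) t<N)
    ; pos-spread    = spread
    }
    where
    spread : ∀ {u w} → u ≢ v → w ≢ v → Edge G u w → rank u < rank w → rank w < rank u + m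
    spread {u} {w} u≢v w≢v uw r< = begin-strict
      rank w                        ≡⟨ rank-gap {u} {w} κu<κw ⟩
      rank u + count (between? u w) <⟨ +-monoʳ-< (rank u) (<-trans between<component (<-≤-trans (component<ω cliques u) ω≤m)) ⟩
      rank u + m                    ∎
      where
      open ≤-Reasoning
      κu<κw : κ u < κ w
      κu<κw = rank⇒κ {u} w≢v r<
      u~w : u ~ w
      u~w = inj₂ (u≢v , w≢v , uw)
      between<component : count (between? u w) < count (component? u)
      between<component = count-strict (between? u w) (component? u)
        (λ x (x≢v , u≤x , x<w) → x≢v , rep-≡⁻ (κ-between (rep-≡ u~w) u≤x (<⇒≤ x<w)))
        (w≢v , ~-sym u~w) (λ (_ , _ , w<w) → <-irrefl refl w<w)

-- Given an enumeration of spread m with N ≤ 2m, colour a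
-- vertex u ≠ v by (position of u) mod m and v by the extra colour m.  The result is
-- an equitable (m + 1)-colouring: the lower classes are residue classes of
-- 0, …, N − 1, of size 1 or 2, balanced according to how N compares with m.
module CyclicColouring {N m : ℕ} .{{_ : NonZero m}} {G : Graph (suc N)} {v : Fin (suc N)}
                       (E : Enumeration G v m) (N≤2m : N ≤ m + m) where
  open Enumeration E

  colourBy : ∀ u → Dec (u ≡ v) → Fin (suc m)
  colourBy u (yes _) = fromℕ m
  colourBy u (no _)  = fromℕ< (m<n⇒m<1+n (m%n<n (pos u) m))

  colour : Fin (suc N) → Fin (suc m)
  colour u = colourBy u (u ≟ v)

  colour-v : toℕ (colour v) ≡ m
  colour-v with v ≟ v
  ... | yes _   = toℕ-fromℕ m
  ... | no v≢v = ⊥-elim (v≢v refl)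

  colour-other : ∀ {u} → u ≢ v → toℕ (colour u) ≡ pos u % m
  colour-other {u} u≢v rewrite dec-no (u ≟ v) u≢v = toℕ-fromℕ< _

  colour-other≢m : ∀ {u} → u ≢ v → toℕ (colour u) ≢ m
  colour-other≢m u≢v c≡m = <-irrefl (trans (sym (colour-other u≢v)) c≡m) (m%n<n _ m)

  -- The colouring is proper: only v has colour m, and adjacent vertices other than v
  -- are less than m positions apart, hence have different residues.
  proper : IsProperColoring G colour
  proper u w uw same = distinct (u ≟ v) (w ≟ v)
    where
    further : ∀ {u w} → u ≢ v → w ≢ v → Edge G u w → pos u < pos w → colour u ≢ colour w
    further u≢v w≢v uw u<w same = residues-differ u<w (pos-spread u≢v w≢v uw u<w)
      (<-≤-trans (pos-bounded w≢v) N≤2m)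
      (trans (sym (colour-other u≢v)) (trans (cong toℕ same) (colour-other w≢v)))
    distinct : Dec (u ≡ v) → Dec (w ≡ v) → ⊥
    distinct (yes refl) (yes refl) = Edge-irrefl G uw
    distinct (yes refl) (no w≢v)  = colour-other≢m w≢v (trans (cong toℕ (sym same)) colour-v)
    distinct (no u≢v)  (yes refl) = colour-other≢m u≢v (trans (cong toℕ same) colour-v)
    distinct (no u≢v)  (no w≢v) with <-cmp (pos u) (pos w)
    ... | tri< u<w _ _ = further u≢v w≢v uw u<w same
    ... | tri≈ _ u≡w _ = Edge⇒≢ G uw (pos-injective u≢v w≢v u≡w)
    ... | tri> _ _ w<u = further w≢v u≢v (Edge-sym G uw) w<u (sym same)

  size : Fin (suc m) → ℕ
  size i = count (λ u → colour u ≟ i)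

  top-or-low : ∀ (i : Fin (suc m)) → toℕ i ≡ m ⊎ toℕ i < m
  top-or-low i with m≤n⇒m<n∨m≡n (m<1+n⇒m≤n (toℕ<n i))
  ... | inj₁ i<m = inj₂ i<m
  ... | inj₂ i≡m = inj₁ i≡m

  size-top : ∀ {i} → toℕ i ≡ m → size i ≡ 1
  size-top {i} i≡m = count-subsingleton (λ u → colour u ≟ i) (λ cx cy → trans (isV cx) (sym (isV cy))) {v}
                                         (toℕ-injective (trans colour-v (sym i≡m)))
    where
    isV : ∀ {x} → colour x ≡ i → x ≡ v
    isV {x} cx = decidable-stable (x ≟ v) (λ x≢v → colour-other≢m x≢v (trans (cong toℕ cx) i≡m))

  member : ∀ {i u} → toℕ i < m → colour u ≡ i → u ≢ v × pos u % m ≡ toℕ i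
  member {i} {u} i<m cu = u≢v , trans (sym (colour-other u≢v)) (cong toℕ cu)
    where
    u≢v : u ≢ v
    u≢v refl = <-irrefl (trans (sym (cong toℕ cu)) colour-v) i<m

  size-low≤ : ∀ {i q} → toℕ i < m → (∀ {u} → u ≢ v → pos u % m ≡ toℕ i → pos u < q * m) → size i ≤ q
  size-low≤ {i} i<m below = residueClass≤ (λ u → colour u ≟ i) pos
    (λ _ _ cx cy → pos-injective (proj₁ (member i<m cx)) (proj₁ (member i<m cy)))
    (λ _ cx → proj₂ (member i<m cx))
    (λ _ cx → below (proj₁ (member i<m cx)) (proj₂ (member i<m cx)))

  size≤2 : ∀ i → size i ≤ 2
  size≤2 i with top-or-low i
  ... | inj₁ i≡m = ≤-trans (≤-reflexive (size-top i≡m)) (s≤s z≤n)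
  ... | inj₂ i<m = size-low≤ i<m (λ u≢v _ → <-≤-trans (pos-bounded u≢v) (≤-trans N≤2m (≤-reflexive 2m≡)))
    where
    2m≡ : m + m ≡ 2 * m
    2m≡ = cong (m +_) (sym (+-identityʳ m))

  size≤1 : N ≤ m → ∀ i → size i ≤ 1
  size≤1 N≤m i with top-or-low i
  ... | inj₁ i≡m = ≤-reflexive (size-top i≡m)
  ... | inj₂ i<m = size-low≤ i<m below
    where
    below : ∀ {u} → u ≢ v → pos u % m ≡ toℕ i → pos u < 1 * m
    below {u} u≢v r with residue-cases {pos u} (<-≤-trans (pos-bounded u≢v) N≤2m)
    ... | inj₁ p≡ = subst (pos u <_) (sym (+-identityʳ m)) (subst (_< m) (sym (trans p≡ r)) i<m)
    ... | inj₂ p≡ = ⊥-elim (<-irrefl refl (<-≤-trans (pos-bounded u≢v) (begin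
          N             ≤⟨ N≤m ⟩
          m             ≤⟨ m≤n+m m (pos u % m) ⟩
          pos u % m + m ≡⟨ p≡ ⟨
          pos u         ∎)))
      where open ≤-Reasoning

  -- Every lower colour j is used once j < N, as the position j is occupied.
  size≥1 : m ≤ N → ∀ i → 1 ≤ size i
  size≥1 m≤N i with top-or-low i
  ... | inj₁ i≡m = ≤-reflexive (sym (size-top i≡m))
  ... | inj₂ i<m with pos-onto (<-≤-trans i<m m≤N)
  ...   | u , u≢v , pu≡i = count-pos (λ u → colour u ≟ i) {u}
            (toℕ-injective (trans (colour-other u≢v) (trans (cong (_% m) pu≡i) (m<n⇒m%n≡m i<m))))

  regime< : N < m → ⌊ suc N / suc m ⌋ ≡ 0 × ⌈ suc N / suc m ⌉ ≡ 1
  regime< N<m = floorCeil-between z<s (subst (suc N <_) (sym (+-identityʳ (suc m))) (s≤s N<m))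

  regime≡ : N ≡ m → ⌊ suc N / suc m ⌋ ≡ 1 × ⌈ suc N / suc m ⌉ ≡ 1
  regime≡ refl = floorCeil-exact (sym (+-identityʳ (suc m)))

  regime> : m < N → ⌊ suc N / suc m ⌋ ≡ 1 × ⌈ suc N / suc m ⌉ ≡ 2
  regime> m<N = floorCeil-between (subst (_< suc N) (sym (+-identityʳ (suc m))) (s≤s m<N)) (begin-strict
    suc N                 ≤⟨ s≤s N≤2m ⟩
    suc (m + m)           <⟨ s≤s (+-monoʳ-< m (n<1+n m)) ⟩
    suc m + suc m         ≡⟨ cong (suc m +_) (+-identityʳ (suc m)) ⟨
    2 * suc m             ∎)
    where open ≤-Reasoning

  floor≤size : ∀ i → ⌊ suc N / suc m ⌋ ≤ size i
  floor≤size i with <-cmp N m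
  ... | tri< N<m _ _ = subst (_≤ size i) (sym (proj₁ (regime< N<m))) z≤n
  ... | tri≈ _ N≡m _ = subst (_≤ size i) (sym (proj₁ (regime≡ N≡m))) (size≥1 (≤-reflexive (sym N≡m)) i)
  ... | tri> _ _ m<N = subst (_≤ size i) (sym (proj₁ (regime> m<N))) (size≥1 (<⇒≤ m<N) i)

  size≤ceil : ∀ i → size i ≤ ⌈ suc N / suc m ⌉
  size≤ceil i with <-cmp N m
  ... | tri< N<m _ _ = subst (size i ≤_) (sym (proj₂ (regime< N<m))) (size≤1 (<⇒≤ N<m) i)
  ... | tri≈ _ N≡m _ = subst (size i ≤_) (sym (proj₂ (regime≡ N≡m))) (size≤1 (≤-reflexive N≡m) i)
  ... | tri> _ _ m<N = subst (size i ≤_) (sym (proj₂ (regime> m<N))) (size≤2 i)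

  colourable : EquitablyColorable G (suc m)
  colourable = colour , proper , λ i → subst (λ s → s ≡ ⌊ suc N / suc m ⌋ ⊎ s ≡ ⌈ suc N / suc m ⌉)
    (sym (∣⟪⟫∣ (λ u → colour u ≟ i))) (squeeze (floor≤size i) (size≤ceil i) (⌈⌉≤⌊⌋+1 (suc N) (suc m)))

module _ {n : ℕ} (G : Graph n) where

  clique≤colours : ∀ {k} {c : Fin n → Fin k} {S} → IsProperColoring G c → IsClique G S → ∣ S ∣ ≤ k
  clique≤colours {k} {c} {S} proper clique = begin
    ∣ S ∣                    ≡⟨ ∣∣≡count S ⟩
    count (_∈? S)            ≤⟨ count-inj (_∈? S) (λ (_ : Fin k) → yes tt) (λ u _ → c u) (λ _ _ → tt) distinct ⟩
    count {k} (λ _ → yes tt) ≡⟨ count-all k ⟩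
    k                        ∎
    where
    open ≤-Reasoning
    distinct : ∀ x y → x ∈ S → y ∈ S → c x ≡ c y → x ≡ y
    distinct x y x∈S y∈S cx≡cy = decidable-stable (x ≟ y) (λ x≢y → proper x y (clique x y x∈S y∈S x≢y) cx≡cy)

  -- With a dominating vertex v the class of v is {v}, so equitability bounds every
  -- class by 2, and n ≤ 1 + 2(k − 1).
  dominated⇒n<2k : ∀ {v k c} → Dominates G v → IsEquitableColoring G k c → n + 1 ≤ k + k
  dominated⇒n<2k {v} {k} {c} dom (proper , equitable) = begin
    n + 1                              ≡⟨ cong (_+ 1) (∑-classes c) ⟨
    ∑ size + 1                         ≤⟨ +-monoˡ-≤ 1 (∑-mono size≤) ⟩
    ∑ (λ i → 1 + ⟦ ¬? (i ≟ c v) ⟧) + 1  ≡⟨ cong (_+ 1) (∑-+ (λ _ → 1) (λ i → ⟦ ¬? (i ≟ c v) ⟧)) ⟩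
    ∑ {k} (λ _ → 1) + others + 1       ≡⟨ +-assoc (∑ {k} (λ _ → 1)) others 1 ⟩
    ∑ {k} (λ _ → 1) + (others + 1)     ≡⟨ cong₂ _+_ (count-all k) (trans (+-comm others 1) (count-complement (c v))) ⟩
    k + k                              ∎
    where
    open ≤-Reasoning
    others : ℕ
    others = count (λ i → ¬? (i ≟ c v))
    size : Fin k → ℕ
    size i = count (λ u → c u ≟ i)
    size∈ : ∀ i → size i ≡ ⌊ n / k ⌋ ⊎ size i ≡ ⌈ n / k ⌉
    size∈ i = subst (λ s → s ≡ ⌊ n / k ⌋ ⊎ s ≡ ⌈ n / k ⌉) (∣⟪⟫∣ (λ u → c u ≟ i)) (equitable i)
    size-cv : size (c v) ≡ 1
    size-cv = count-subsingleton (λ u → c u ≟ c v) (λ cx cy → trans (isV cx) (sym (isV cy))) {v} refl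
      where
      isV : ∀ {x} → c x ≡ c v → x ≡ v
      isV {x} cx = decidable-stable (x ≟ v) (λ x≢v → proper v x (dom x x≢v) (sym cx))
    size≤ : ∀ i → size i ≤ 1 + ⟦ ¬? (i ≟ c v) ⟧
    size≤ i with i ≟ c v
    ... | yes refl = ≤-reflexive size-cv
    ... | no _     = ≤-trans (balanced (⌊⌋≤⌈⌉ n k) (⌈⌉≤⌊⌋+1 n k) (size∈ i) (size∈ (c v)))
                             (≤-reflexive (cong (_+ 1) size-cv))

corollary7 : (n : ℕ) (G : Graph n) → IsBlockGraph G
           → (a : ℕ) → IsAlphaMin G a → a ≡ 1
           → (ω : ℕ) → IsCliqueNumber G ω
           → (χ : ℕ) → IsEqChromatic G χ
           → let X = ω ⊔ ⌈ (n + 1) / (a + 1) ⌉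
             in X ≤ χ × χ ≤ X + 1
corollary7 zero    G _ _ ((() , _) , _) _ _ _ _ _
corollary7 (suc N) G blockGraph a ((v , _ , α≤1) , _) refl ω ((S , clique , ∣S∣≡ω) , cliques)
           χ ((c , equitable) , χ-minimal) = ⊔-lub ω≤χ ceil≤χ , χ≤X+1
  where
  dom : Dominates G v
  dom = α≤1⇒dominates G α≤1
  ceil X : ℕ
  ceil = ⌈ (suc N + 1) / 2 ⌉
  X = ω ⊔ ceil
  ω≤χ : ω ≤ χ
  ω≤χ = subst (_≤ χ) ∣S∣≡ω (clique≤colours G (proj₁ equitable) clique)
  ceil≤χ : ceil ≤ χ
  ceil≤χ = ceilHalf≤ (suc N) χ (dominated⇒n<2k G dom equitable)
  n+1≤2X : suc N + 1 ≤ X + X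
  n+1≤2X = ceilHalf≥ (suc N) X (m≤n⊔m ω ceil)
  instance
    X≢0 : NonZero X
    X≢0 = >-nonZero (double-positive n+1≤2X)
  N≤2X : N ≤ X + X
  N≤2X = ≤-trans (≤-trans (n≤1+n N) (m≤m+n (suc N) 1)) n+1≤2X
  χ≤X+1 : χ ≤ X + 1
  χ≤X+1 = ≤-trans (χ-minimal (suc X) (CyclicColouring.colourable
                     (Components.enumeration G blockGraph v dom cliques (m≤m⊔n ω ceil)) N≤2X))
                  (≤-reflexive (+-comm 1 X))
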